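{- For every finite simple graph $G$, there exists a finite simple graph $G'$ such that $G$ is isomorphic to an induced subgraph of $L_{G'}$.
   Context: A biclique of a graph $G'$ is a vertex set $B\subseteq V(G')$ such that $G'[B]$ is a complete bipartite graph and $B$ is inclusion-wise maximal with this property. The biclique line graph $L_{G'}$ has vertex set $E(G')$, two edges of $G'$ being adjacent iff they are both edges of $G'[B]$ for some biclique $B$ of $G'$. -}

module Defs where

open import Data.Nat using (ℕ)
open import Data.Fin using (Fin; _<_)
open import Data.Fin.Subset using (Subset; _∈_; _∉_; _⊆_)
open import Data.Bool using (Bool; true; false)
open import Data.Product using (Σ; ∃; ∃-syntax; _×_; _,_; proj₁; proj₂)
open import Data.Sum using (_⊎_)
open import Relation.Nullary using (¬_)
open import Relation.Binary.PropositionalEquality using (_≡_)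
open import Function.Bundles using (_⇔_)

record Graph (n : ℕ) : Set where
  field
    adj    : Fin n → Fin n → Bool
    sym    : ∀ u v → adj u v ≡ adj v u
    irrefl : ∀ v → adj v v ≡ false
open Graph public

module _ {m : ℕ} (G : Graph m) where

  IsCompleteBipartite : Subset m → Set
  IsCompleteBipartite B = Σ (Subset m) λ X → Σ (Subset m) λ Y →
      (∀ v → v ∈ B ⇔ (v ∈ X ⊎ v ∈ Y))
    × (∀ v → v ∈ X → v ∉ Y)
    × (∃[ x ] x ∈ X) × (∃[ y ] y ∈ Y)
    × (∀ x y → x ∈ X → y ∈ Y → adj G x y ≡ true)
    × (∀ x x′ → x ∈ X → x′ ∈ X → adj G x x′ ≡ false)
    × (∀ y y′ → y ∈ Y → y′ ∈ Y → adj G y y′ ≡ false)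

  IsBiclique : Subset m → Set
  IsBiclique B = IsCompleteBipartite B
    × (∀ B′ → B ⊆ B′ → IsCompleteBipartite B′ → B′ ⊆ B)

  -- Edges of G, each represented once as an ordered pair (u , v) with u < v.
  Edge : Set
  Edge = Σ (Fin m) λ u → Σ (Fin m) λ v → (u < v) × (adj G u v ≡ true)

  src tgt : Edge → Fin m
  src e = proj₁ e
  tgt e = proj₁ (proj₂ e)

  SameEdge : Edge → Edge → Set
  SameEdge e f = (src e ≡ src f) × (tgt e ≡ tgt f)

  EdgeIn : Edge → Subset m → Set
  EdgeIn e B = (src e ∈ B) × (tgt e ∈ B)

  -- Adjacency in the biclique line graph L_G (vertex set: Edge):
  -- distinct edges lying together in G[B] for some biclique B.
  LAdj : Edge → Edge → Set
  LAdj e f = ¬ SameEdge e f × (∃[ B ] (IsBiclique B × EdgeIn e B × EdgeIn f B))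

InducedInBicliqueLineGraph : {n m : ℕ} → Graph n → Graph m → Set
InducedInBicliqueLineGraph {n} G G′ =
  Σ (Fin n → Edge G′) λ φ →
      (∀ i j → SameEdge G′ (φ i) (φ j) → i ≡ j)
    × (∀ i j → (adj G i j ≡ true) ⇔ LAdj G′ (φ i) (φ j))

-- Let G′ be the bipartite graph on two copies a₁ … aₙ, b₁ … bₙ of V(G) in which
-- aₖbₗ is an edge iff k = l or kl ∈ E(G), and send k to the edge aₖbₖ.  If
-- kl ∈ E(G), then {aₖ, aₗ, bₖ, bₗ} induces a 4-cycle, a complete bipartite set,
-- which extends to a biclique.  Conversely, on a complete bipartite set
-- non-adjacency is transitive (it means "same side"), so in a biclique
-- containing aₖ, bₖ, aₗ, bₗ the chain aₖ ≁ aₗ ≁ bₖ is impossible because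
-- aₖ ∼ bₖ; hence aₗ ∼ bₖ, that is k = l or kl ∈ E(G).
module Submission where

open import Defs
open import Data.Nat using (ℕ; _+_)
open import Data.Nat.Properties using (<-≤-trans; m≤m+n)
open import Data.Fin using (Fin; _<_; _↑ˡ_; _↑ʳ_; splitAt; toℕ)
open import Data.Fin.Properties
  using (_≟_; splitAt-↑ˡ; splitAt-↑ʳ; ↑ˡ-injective; toℕ-↑ˡ; toℕ-↑ʳ; toℕ<n; any?; all?)
open import Data.Fin.Subset using (Subset; _∈_; _∉_; _⊆_; _⊃_; ⁅_⁆; _∪_)
open import Data.Fin.Subset.Properties
  using (_∈?_; _⊂?_; anySubset?; x∈⁅x⁆; x∈⁅y⁆⇒x≡y; x∈p∪q⁺; x∈p∪q⁻)
open import Data.Fin.Subset.Induction using (⊃-wellFounded)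
open import Induction.WellFounded using (Acc; acc)
open import Data.Bool using (Bool; true; false; _∨_)
open import Data.Bool.Properties using (∨-zeroʳ) renaming (_≟_ to _≟ᵇ_)
open import Data.Product using (Σ; ∃-syntax; _×_; _,_; proj₁; proj₂)
open import Data.Sum using (_⊎_; inj₁; inj₂)
open import Function using (_∘_; id)
open import Function.Bundles using (_⇔_; mk⇔; Equivalence)
open import Relation.Nullary using (Dec; yes; no; does; contradiction)
open import Relation.Nullary.Decidable
  using (map′; _×-dec_; _→-dec_; _⊎-dec_; ¬?; dec-true; dec-false)
open import Relation.Unary using (Pred; Decidable)
open import Relation.Binary.PropositionalEquality
  using (_≡_; _≢_; refl; trans; cong; cong₂)
import Relation.Binary.PropositionalEquality as ≡

_⇔-dec_ : {A B : Set} → Dec A → Dec B → Dec (A ⇔ B)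
a? ⇔-dec b? = map′ (λ (f , g) → mk⇔ f g) (λ e → Equivalence.to e , Equivalence.from e)
                   ((a? →-dec b?) ×-dec (b? →-dec a?))

true≡false-elim : {A : Set} {b : Bool} → b ≡ true → b ≡ false → A
true≡false-elim refl ()

Maximal : ∀ {m ℓ} → Pred (Subset m) ℓ → Pred (Subset m) ℓ
Maximal P B = P B × (∀ B′ → B ⊆ B′ → P B′ → B′ ⊆ B)

extendToMaximal : ∀ {m ℓ} {P : Pred (Subset m) ℓ} → Decidable P →
                  ∀ {B} → P B → ∃[ B′ ] B ⊆ B′ × Maximal P B′
extendToMaximal {P = P} P? {B} = go B (⊃-wellFounded B)
  where
  go : ∀ B → Acc _⊃_ B → P B → ∃[ B′ ] B ⊆ B′ × Maximal P B′
  go B (acc larger) pB with anySubset? (λ C → (B ⊂? C) ×-dec P? C)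
  ... | yes (C , B⊂C , pC) =
    let B′ , C⊆B′ , maximal = go C (larger B⊂C) pC in B′ , C⊆B′ ∘ proj₁ B⊂C , maximal
  ... | no noLarger = B , id , pB , maximal
    where
    maximal : ∀ C → B ⊆ C → P C → C ⊆ B
    maximal C B⊆C pC {x} x∈C with x ∈? B
    ... | yes x∈B = x∈B
    ... | no x∉B = contradiction (C , ((λ {y} → B⊆C {y}) , x , x∈C , x∉B) , pC) noLarger

module _ {m : ℕ} (G : Graph m) where

  isCompleteBipartite? : Decidable (IsCompleteBipartite G)
  isCompleteBipartite? B = anySubset? λ X → anySubset? λ Y →
          all? (λ v → (v ∈? B) ⇔-dec ((v ∈? X) ⊎-dec (v ∈? Y)))
    ×-dec all? (λ v → (v ∈? X) →-dec ¬? (v ∈? Y))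
    ×-dec any? (_∈? X)
    ×-dec any? (_∈? Y)
    ×-dec all? (λ x → all? λ y → (x ∈? X) →-dec ((y ∈? Y) →-dec (adj G x y ≟ᵇ true)))
    ×-dec all? (λ x → all? λ y → (x ∈? X) →-dec ((y ∈? X) →-dec (adj G x y ≟ᵇ false)))
    ×-dec all? (λ x → all? λ y → (x ∈? Y) →-dec ((y ∈? Y) →-dec (adj G x y ≟ᵇ false)))

  Independent : Subset m → Set
  Independent X = ∀ x x′ → x ∈ X → x′ ∈ X → adj G x x′ ≡ false

  CompletelyJoined : Subset m → Subset m → Set
  CompletelyJoined X Y = ∀ x y → x ∈ X → y ∈ Y → adj G x y ≡ true

  ∪-isCompleteBipartite : ∀ {X Y} → (∀ v → v ∈ X → v ∉ Y) → ∃[ x ] x ∈ X → ∃[ y ] y ∈ Y →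
                          CompletelyJoined X Y → Independent X → Independent Y →
                          IsCompleteBipartite G (X ∪ Y)
  ∪-isCompleteBipartite {X} {Y} disjoint x y joined indepX indepY =
    X , Y , (λ _ → mk⇔ (x∈p∪q⁻ X Y) x∈p∪q⁺) , disjoint , x , y , joined , indepX , indepY

  nonadjacent-trans : ∀ {B} → IsCompleteBipartite G B → ∀ {u v w} → u ∈ B → v ∈ B → w ∈ B →
                      adj G u v ≡ false → adj G v w ≡ false → adj G u w ≡ false
  nonadjacent-trans (X , Y , B⇔X⊎Y , _ , _ , _ , joined , indepX , indepY) {u} {v} {w} u∈B v∈B w∈B u≁v v≁w
    with side u∈B | side v∈B | side w∈B
    where
    side : ∀ {x} → x ∈ _ → x ∈ X ⊎ x ∈ Y
    side = Equivalence.to (B⇔X⊎Y _)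
  ... | inj₁ u∈X | _        | inj₁ w∈X = indepX u w u∈X w∈X
  ... | inj₂ u∈Y | _        | inj₂ w∈Y = indepY u w u∈Y w∈Y
  ... | inj₁ u∈X | inj₂ v∈Y | _        = true≡false-elim (joined u v u∈X v∈Y) u≁v
  ... | inj₂ u∈Y | inj₁ v∈X | _        =
    true≡false-elim (joined v u v∈X u∈Y) (trans (≡.sym (sym G u v)) u≁v)
  ... | inj₁ _   | inj₁ v∈X | inj₂ w∈Y = true≡false-elim (joined v w v∈X w∈Y) v≁w
  ... | inj₂ _   | inj₂ v∈Y | inj₁ w∈X =
    true≡false-elim (joined w v w∈X v∈Y) (trans (≡.sym (sym G v w)) v≁w)

x∈⁅x⁆∪⁅y⁆ : ∀ {m} {x y : Fin m} → x ∈ ⁅ x ⁆ ∪ ⁅ y ⁆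
x∈⁅x⁆∪⁅y⁆ = x∈p∪q⁺ (inj₁ (x∈⁅x⁆ _))

y∈⁅x⁆∪⁅y⁆ : ∀ {m} {x y : Fin m} → y ∈ ⁅ x ⁆ ∪ ⁅ y ⁆
y∈⁅x⁆∪⁅y⁆ = x∈p∪q⁺ (inj₂ (x∈⁅x⁆ _))

∈⁅f-a⁆∪⁅f-b⁆⁻ : ∀ {A : Set} {m} (f : A → Fin m) {a b z} → z ∈ ⁅ f a ⁆ ∪ ⁅ f b ⁆ →
                ∃[ c ] (c ≡ a ⊎ c ≡ b) × z ≡ f c
∈⁅f-a⁆∪⁅f-b⁆⁻ f {a} {b} z∈ with x∈p∪q⁻ ⁅ f a ⁆ ⁅ f b ⁆ z∈
... | inj₁ z∈⁅fa⁆ = a , inj₁ refl , x∈⁅y⁆⇒x≡y _ z∈⁅fa⁆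
... | inj₂ z∈⁅fb⁆ = b , inj₂ refl , x∈⁅y⁆⇒x≡y _ z∈⁅fb⁆

module _ {p q : ℕ} where

  left : Fin p → Fin (p + q)
  left k = k ↑ˡ q

  right : Fin q → Fin (p + q)
  right l = p ↑ʳ l

  bipartite : (Fin p → Fin q → Bool) → Graph (p + q)
  bipartite R = record
    { adj    = λ u v → adjᴮ (splitAt p u) (splitAt p v)
    ; sym    = λ u v → adjᴮ-sym (splitAt p u) (splitAt p v)
    ; irrefl = λ v → adjᴮ-irrefl (splitAt p v) }
    where
    adjᴮ : Fin p ⊎ Fin q → Fin p ⊎ Fin q → Bool
    adjᴮ (inj₁ k) (inj₁ k′) = false
    adjᴮ (inj₁ k) (inj₂ l)  = R k l
    adjᴮ (inj₂ l) (inj₁ k)  = R k l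
    adjᴮ (inj₂ l) (inj₂ l′) = false

    adjᴮ-sym : ∀ s t → adjᴮ s t ≡ adjᴮ t s
    adjᴮ-sym (inj₁ _) (inj₁ _) = refl
    adjᴮ-sym (inj₁ _) (inj₂ _) = refl
    adjᴮ-sym (inj₂ _) (inj₁ _) = refl
    adjᴮ-sym (inj₂ _) (inj₂ _) = refl

    adjᴮ-irrefl : ∀ s → adjᴮ s s ≡ false
    adjᴮ-irrefl (inj₁ _) = refl
    adjᴮ-irrefl (inj₂ _) = refl

  module _ (R : Fin p → Fin q → Bool) where

    adj-left-right : ∀ k l → adj (bipartite R) (left k) (right l) ≡ R k l
    adj-left-right k l rewrite splitAt-↑ˡ p k q | splitAt-↑ʳ p q l = refl

    adj-left-left : ∀ k k′ → adj (bipartite R) (left k) (left k′) ≡ false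
    adj-left-left k k′ rewrite splitAt-↑ˡ p k q | splitAt-↑ˡ p k′ q = refl

    adj-right-right : ∀ l l′ → adj (bipartite R) (right l) (right l′) ≡ false
    adj-right-right l l′ rewrite splitAt-↑ʳ p q l | splitAt-↑ʳ p q l′ = refl

  left≢right : ∀ k l → left k ≢ right l
  left≢right k l eq with trans (≡.sym (splitAt-↑ˡ p k q))
                             (trans (cong (splitAt p) eq) (splitAt-↑ʳ p q l))
  ... | ()

  left<right : ∀ k l → left k < right l
  left<right k l rewrite toℕ-↑ˡ k q | toℕ-↑ʳ p l = <-≤-trans (toℕ<n k) (m≤m+n p (toℕ l))

module _ {n : ℕ} (G : Graph n) where

  closedAdj : Fin n → Fin n → Bool
  closedAdj i j = does (i ≟ j) ∨ adj G i j

  closedAdj-refl : ∀ k → closedAdj k k ≡ true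
  closedAdj-refl k = cong (_∨ adj G k k) (dec-true (k ≟ k) refl)

  adj⇒closedAdj : ∀ {i j} → adj G i j ≡ true → closedAdj i j ≡ true
  adj⇒closedAdj {i} {j} i∼j = trans (cong (does (i ≟ j) ∨_) i∼j) (∨-zeroʳ _)

  closedAdj-false : ∀ {i j} → i ≢ j → adj G i j ≡ false → closedAdj i j ≡ false
  closedAdj-false {i} i≢j i≁j = cong₂ _∨_ (dec-false (i ≟ _) i≢j) i≁j

  closedAdj-edge : ∀ {i j k l} → adj G i j ≡ true →
                   (k ≡ i ⊎ k ≡ j) → (l ≡ i ⊎ l ≡ j) → closedAdj k l ≡ true
  closedAdj-edge {k = k} i∼j (inj₁ refl) (inj₁ refl) = closedAdj-refl k
  closedAdj-edge         i∼j (inj₁ refl) (inj₂ refl) = adj⇒closedAdj i∼j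
  closedAdj-edge {i} {j} i∼j (inj₂ refl) (inj₁ refl) = adj⇒closedAdj (trans (sym G j i) i∼j)
  closedAdj-edge {k = k} i∼j (inj₂ refl) (inj₂ refl) = closedAdj-refl k

bipartiteDouble : ∀ {n} → Graph n → Graph (n + n)
bipartiteDouble G = bipartite (closedAdj G)

diagonalEdge : ∀ {n} (G : Graph n) → Fin n → Edge (bipartiteDouble G)
diagonalEdge G k =
  left k , right k , left<right k k , trans (adj-left-right (closedAdj G) k k) (closedAdj-refl G k)

module _ {n : ℕ} (G : Graph n) where

  private
    G² : Graph (n + n)
    G² = bipartiteDouble G

    a b : Fin n → Fin (n + n)
    a = left
    b = right

  diagonalEdge-injective : ∀ {i j} → SameEdge G² (diagonalEdge G i) (diagonalEdge G j) → i ≡ j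
  diagonalEdge-injective {i} {j} (same-left , _) = ↑ˡ-injective n i j same-left

  square : Fin n → Fin n → Subset (n + n)
  square i j = (⁅ a i ⁆ ∪ ⁅ a j ⁆) ∪ (⁅ b i ⁆ ∪ ⁅ b j ⁆)

  square-isCompleteBipartite : ∀ {i j} → adj G i j ≡ true → IsCompleteBipartite G² (square i j)
  square-isCompleteBipartite {i} {j} i∼j = ∪-isCompleteBipartite G² disjoint
    (a i , x∈⁅x⁆∪⁅y⁆) (b i , x∈⁅x⁆∪⁅y⁆) joined independentˡ independentʳ
    where
    disjoint : ∀ v → v ∈ ⁅ a i ⁆ ∪ ⁅ a j ⁆ → v ∉ ⁅ b i ⁆ ∪ ⁅ b j ⁆
    disjoint v v∈ˡ v∈ʳ with ∈⁅f-a⁆∪⁅f-b⁆⁻ a v∈ˡ | ∈⁅f-a⁆∪⁅f-b⁆⁻ b v∈ʳ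
    ... | k , _ , refl | l , _ , eq = left≢right k l eq

    joined : CompletelyJoined G² (⁅ a i ⁆ ∪ ⁅ a j ⁆) (⁅ b i ⁆ ∪ ⁅ b j ⁆)
    joined x y x∈ y∈ with ∈⁅f-a⁆∪⁅f-b⁆⁻ a x∈ | ∈⁅f-a⁆∪⁅f-b⁆⁻ b y∈
    ... | k , k∈ij , refl | l , l∈ij , refl =
      trans (adj-left-right (closedAdj G) k l) (closedAdj-edge G i∼j k∈ij l∈ij)

    independentˡ : Independent G² (⁅ a i ⁆ ∪ ⁅ a j ⁆)
    independentˡ x x′ x∈ x′∈ with ∈⁅f-a⁆∪⁅f-b⁆⁻ a x∈ | ∈⁅f-a⁆∪⁅f-b⁆⁻ a x′∈
    ... | k , _ , refl | k′ , _ , refl = adj-left-left (closedAdj G) k k′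

    independentʳ : Independent G² (⁅ b i ⁆ ∪ ⁅ b j ⁆)
    independentʳ y y′ y∈ y′∈ with ∈⁅f-a⁆∪⁅f-b⁆⁻ b y∈ | ∈⁅f-a⁆∪⁅f-b⁆⁻ b y′∈
    ... | l , _ , refl | l′ , _ , refl = adj-right-right (closedAdj G) l l′

  adj⇒LAdj : ∀ {i j} → adj G i j ≡ true → LAdj G² (diagonalEdge G i) (diagonalEdge G j)
  adj⇒LAdj {i} {j} i∼j
    with extendToMaximal (isCompleteBipartite? G²) (square-isCompleteBipartite i∼j)
  ... | B , square⊆B , biclique =
    i≢j ∘ diagonalEdge-injective , B , biclique ,
    (square⊆B (x∈p∪q⁺ (inj₁ x∈⁅x⁆∪⁅y⁆)) , square⊆B (x∈p∪q⁺ (inj₂ x∈⁅x⁆∪⁅y⁆))) ,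
    (square⊆B (x∈p∪q⁺ (inj₁ y∈⁅x⁆∪⁅y⁆)) , square⊆B (x∈p∪q⁺ (inj₂ y∈⁅x⁆∪⁅y⁆)))
    where
    i≢j : i ≢ j
    i≢j refl = true≡false-elim i∼j (irrefl G i)

  LAdj⇒adj : ∀ {i j} → LAdj G² (diagonalEdge G i) (diagonalEdge G j) → adj G i j ≡ true
  LAdj⇒adj {i} {j} (distinct , B , (isCB , _) , (aᵢ∈B , bᵢ∈B) , (aⱼ∈B , _)) with adj G i j in i∼j
  ... | true  = refl
  ... | false = true≡false-elim aᵢ∼bᵢ
                  (nonadjacent-trans G² isCB aᵢ∈B aⱼ∈B bᵢ∈B (adj-left-left (closedAdj G) i j) aⱼ≁bᵢ)
    where
    aᵢ∼bᵢ : adj G² (a i) (b i) ≡ true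
    aᵢ∼bᵢ = proj₂ (proj₂ (proj₂ (diagonalEdge G i)))

    aⱼ≁bᵢ : adj G² (a j) (b i) ≡ false
    aⱼ≁bᵢ = trans (adj-left-right (closedAdj G) j i)
                  (closedAdj-false G (λ { refl → distinct (refl , refl) }) (trans (sym G j i) i∼j))

proposition16 : (n : ℕ) (G : Graph n) →
    Σ ℕ λ m → Σ (Graph m) λ G′ → InducedInBicliqueLineGraph G G′
proposition16 n G = n + n , bipartiteDouble G , diagonalEdge G ,
  (λ _ _ → diagonalEdge-injective G) , λ _ _ → mk⇔ (adj⇒LAdj G) (LAdj⇒adj G)
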